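{- Let $f,g\in\mathbb R_{\ge 0}[x_1,\ldots,x_n]$ both have saturated Newton polytope, and suppose $\mathrm{Newton}(f)$ and $\mathrm{Newton}(g)$ are generalized permutahedra. Then (i) $\mathrm{Newton}(fg)$ is a generalized permutahedron, and (ii) $fg$ has saturated Newton polytope.
   Context: The support of a polynomial is the set of exponent vectors of its monomials with nonzero coefficient; $\mathrm{Newton}(f)\subseteq\mathbb R^n$ is the convex hull of the support of $f$. A polynomial $f$ has saturated Newton polytope (SNP) if every lattice point of $\mathrm{Newton}(f)$ lies in the support of $f$. A submodular function is a map $z:2^{[n]}\to\mathbb R$ with $z_\emptyset=0$ and $z_I+z_J\ge z_{I\cup J}+z_{I\cap J}$ for all $I,J\subseteq[n]$. A generalized permutahedron is a polytope of the form $P(z)=\{t\in\mathbb R^n:\sum_{i\in I}t_i\le z_I \text{ for } I\ne[n],\ \sum_{i=1}^n t_i=z_{[n]}\}$ for a submodular function $z$ (equivalently, a deformation of the standard permutahedron preserving edge directions, with edges allowed to degenerate).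
   Formalization: The polynomials f and g have nonnegative rational coefficients instead of nonnegative real ones. -}

module Defs where

open import Data.Nat using (ℕ)
open import Data.Integer using (ℤ; +_)
open import Data.Rational using (ℚ; 0ℚ; 1ℚ; _+_; _*_; _≤_; _/_)
open import Data.Fin using (Fin)
open import Data.Fin.Subset using (Subset; ⊥; ⊤; _∪_; _∩_; _∈_)
open import Data.Vec using (Vec; lookup; tabulate; zipWith; replicate; map)
open import Data.Vec.Properties using (≡-dec)
open import Data.List using (List; []; _∷_; foldr; concatMap)
import Data.List as L
open import Data.Nat.Properties using () renaming (_≟_ to _≟ℕ_)
open import Data.Product using (_×_; _,_; Σ; ∃; proj₁; proj₂)
open import Relation.Nullary using (¬_; yes; no)
open import Relation.Nullary.Decidable using (⌊_⌋)
open import Relation.Binary.PropositionalEquality using (_≡_; _≢_)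
open import Data.Bool using (Bool; if_then_else_)
open import Function.Bundles using (_⇔_)

Exp : ℕ → Set
Exp n = Vec ℕ n

-- A polynomial in n variables with rational coefficients, represented as a
-- finite formal sum  Σ c · x^a  of terms (a , c).  Repeated exponents are
-- allowed; the actual coefficient is obtained by summing (see coeff).
Poly : ℕ → Set
Poly n = List (Exp n × ℚ)

sumℚ : List ℚ → ℚ
sumℚ = foldr _+_ 0ℚ

coeff : ∀ {n} → Poly n → Exp n → ℚ
coeff p m = sumℚ (L.map proj₂ (L.filter (λ t → ≡-dec _≟ℕ_ (proj₁ t) m) p))

_·_ : ∀ {n} → Poly n → Poly n → Poly n
p · q = concatMap (λ s → L.map (λ t → (zipWith Data.Nat._+_ (proj₁ s) (proj₁ t) , proj₂ s * proj₂ t)) q) p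

Nonneg : ∀ {n} → Poly n → Set
Nonneg p = ∀ m → 0ℚ ≤ coeff p m

InSupport : ∀ {n} → Poly n → Exp n → Set
InSupport p m = coeff p m ≢ 0ℚ

ℕtoℚ : ℕ → ℚ
ℕtoℚ k = (+ k) / 1

ℤtoℚ : ℤ → ℚ
ℤtoℚ k = k / 1

_+ᵥ_ : ∀ {n} → Vec ℚ n → Vec ℚ n → Vec ℚ n
_+ᵥ_ = zipWith _+_

_*ᵥ_ : ∀ {n} → ℚ → Vec ℚ n → Vec ℚ n
c *ᵥ v = map (c *_) v

0ᵥ : ∀ {n} → Vec ℚ n
0ᵥ = replicate _ 0ℚ

InConvexHull : ∀ {n} → (Exp n → Set) → Vec ℚ n → Set
InConvexHull {n} S t =
  Σ (List (ℚ × Exp n)) λ ws →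
      (∀ w → w Data.List.Membership.Propositional.∈ ws → (0ℚ ≤ proj₁ w) × S (proj₂ w))
    × (sumℚ (L.map proj₁ ws) ≡ 1ℚ)
    × (foldr (λ w acc → (proj₁ w *ᵥ map ℕtoℚ (proj₂ w)) +ᵥ acc) 0ᵥ ws ≡ t)
  where import Data.List.Membership.Propositional

InNewton : ∀ {n} → Poly n → Vec ℚ n → Set
InNewton p = InConvexHull (InSupport p)

SNP : ∀ {n} → Poly n → Set
SNP {n} p = ∀ (m : Vec ℤ n) → InNewton p (map ℤtoℚ m) →
            Σ (Exp n) λ a → InSupport p a × map +_ a ≡ m

sumOver : ∀ {n} → Subset n → Vec ℚ n → ℚ
sumOver {n} I t = sumℚ (Data.Vec.toList (tabulate λ i → if ⌊ Data.Fin.Subset.Properties._∈?_ i I ⌋ then lookup t i else 0ℚ))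
  where import Data.Fin.Subset.Properties

Submodular : ∀ {n} → (Subset n → ℚ) → Set
Submodular z = (z ⊥ ≡ 0ℚ) × (∀ I J → (z (I ∪ J) + z (I ∩ J)) ≤ (z I + z J))

InP : ∀ {n} → (Subset n → ℚ) → Vec ℚ n → Set
InP z t = (∀ I → I ≢ ⊤ → sumOver I t ≤ z I) × (sumOver ⊤ t ≡ z ⊤)

NewtonIsGenPerm : ∀ {n} → Poly n → Set
NewtonIsGenPerm p = Σ _ λ z → Submodular z × (∀ t → InNewton p t ⇔ InP z t)

{-# OPTIONS --safe #-}
-- For submodular z, P(z₁) + P(z₂) = P(z₁ + z₂): a point of P(z₁ + z₂) is split one coordinate at a
-- time, the first coordinate of the z₁-part being the largest of finitely many lower bounds, each of
-- which lies below every upper bound by submodularity. The splitting only adds, subtracts and takes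
-- maxima, so integer points split into integer points when z₁ and z₂ are integer valued.
-- With nonnegative coefficients nothing cancels in f · g, so supp(fg) = supp f + supp g and
-- Newton(fg) = Newton f + Newton g = P(z_f + z_g). If Newton f = P(z_f), each z_f(I) is the maximum
-- of sumIn I over Newton f, attained at an exponent of f, hence an integer. So a lattice point of
-- Newton(fg) is a sum of lattice points of Newton f and Newton g, which are exponents by SNP.
module Submission where

open import Defs
open import Data.Nat using (ℕ)
open import Data.Product using (_×_)

open import Data.Bool using (Bool; true; false; if_then_else_; _∧_; _∨_)
open import Data.Empty using (⊥-elim)
open import Data.Fin as Fin using (Fin)
open import Data.Fin.Subset using (Subset; ⊥; ⊤; _∪_; _∩_)
import Data.Fin.Subset.Properties as SubsetP
open import Data.Integer as ℤ using (ℤ)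
import Data.Integer.Properties as ℤP
open import Data.List as List using (List; []; _∷_; _++_)
open import Data.List.Membership.Propositional using (_∈_)
open import Data.List.Membership.Propositional.Properties using (∈-map⁺; ∈-++⁺ˡ; ∈-++⁺ʳ; ∈-deduplicate⁺)
import Data.List.Relation.Unary.All as ListAll
import Data.List.Relation.Unary.All.Properties as ListAllP
open import Data.List.Relation.Unary.AllPairs using ([]; _∷_)
open import Data.List.Relation.Unary.Any using (here; there)
open import Data.List.Relation.Unary.Unique.Propositional using (Unique)
open import Data.List.Relation.Unary.Unique.DecPropositional.Properties using (deduplicate-!)
open import Data.Nat as ℕ using (zero; suc)
import Data.Nat.Properties as ℕP
open import Data.Product using (∃-syntax; _,_; proj₁; proj₂)
open import Data.Rational as ℚ using (ℚ; 0ℚ; 1ℚ; _+_; _*_; _-_; -_; _≤_; _<_; _⊓_)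
open import Data.Rational.Literals using (fromℤ)
import Data.Rational.Properties as ℚP
open import Data.Sum using (inj₁; inj₂)
import Data.Unit as Unit
open import Data.Vec as Vec using (Vec; []; _∷_; lookup; tabulate; zipWith)
import Data.Vec.Properties as VecP
open import Data.Vec.Relation.Unary.All as VecAll using ([]; _∷_) renaming (All to AllV)
open import Function.Base using (_∘_)
open import Function.Bundles using (_⇔_; mk⇔; Equivalence)
import Function.Properties.Equivalence as ⇔
open import Relation.Binary.Bundles using (DecTotalOrder)
open import Relation.Binary.Definitions using (tri<; tri≈; tri>)
open import Relation.Binary.PropositionalEquality
open import Relation.Nullary.Decidable using (Dec; ⌊_⌋; ⌊⌋-map′; dec⇒maybe; yes; no)
open import Tactic.RingSolver using (solve-∀)
open import Tactic.RingSolver.Core.AlmostCommutativeRing using (AlmostCommutativeRing; fromCommutativeRing)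

open import Data.List.Extrema (DecTotalOrder.totalOrder ℚP.≤-decTotalOrder) using (argmax; argmax-all; f[xs]≤f[argmax])

ℚ-ring : AlmostCommutativeRing _ _
ℚ-ring = fromCommutativeRing ℚP.+-*-commutativeRing (λ x → dec⇒maybe (0ℚ ℚP.≟ x))

interchange : ∀ p q r s → (p + q) + (r + s) ≡ (p + r) + (q + s)
interchange = solve-∀ ℚ-ring

p+[q-p]≡q : ∀ p q → p + (q - p) ≡ q
p+[q-p]≡q = solve-∀ ℚ-ring

-- An inequality l ≤ r is proved by exhibiting r - l as a sum of nonnegative gaps;
-- the identity is left to the ring solver.

p≤q⇒0≤q-p : ∀ {p q} → p ≤ q → 0ℚ ≤ q - p
p≤q⇒0≤q-p {p} {q} p≤q = subst (_≤ q - p) (ℚP.+-inverseʳ p) (ℚP.+-monoˡ-≤ (- p) p≤q)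

≤-byDifference : ∀ {l r s} → 0ℚ ≤ s → r - l ≡ s → l ≤ r
≤-byDifference {l} {r} 0≤s r-l≡s =
  subst₂ _≤_ (ℚP.+-identityˡ l) (cancel l r) (ℚP.+-monoˡ-≤ l (subst (0ℚ ≤_) (sym r-l≡s) 0≤s))
  where
  cancel : ∀ l r → (r - l) + l ≡ r
  cancel = solve-∀ ℚ-ring

infixl 6 _⊕_
_⊕_ : ∀ {p q} → 0ℚ ≤ p → 0ℚ ≤ q → 0ℚ ≤ p + q
_⊕_ = ℚP.+-mono-≤

p-r≤q⇒p-q≤r : ∀ {p q r} → p - r ≤ q → p - q ≤ r
p-r≤q⇒p-q≤r {p} {q} {r} p-r≤q = ≤-byDifference (p≤q⇒0≤q-p p-r≤q) (rearrange p q r)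
  where
  rearrange : ∀ p q r → r - (p - q) ≡ q - (p - r)
  rearrange = solve-∀ ℚ-ring

q≤p-r⇒r≤p-q : ∀ {p q r} → q ≤ p - r → r ≤ p - q
q≤p-r⇒r≤p-q {p} {q} {r} q≤p-r = ≤-byDifference (p≤q⇒0≤q-p q≤p-r) (rearrange p q r)
  where
  rearrange : ∀ p q r → (p - q) - r ≡ (p - r) - q
  rearrange = solve-∀ ℚ-ring

0≤* : ∀ {p q} → 0ℚ ≤ p → 0ℚ ≤ q → 0ℚ ≤ p * q
0≤* {p} {q} 0≤p 0≤q =
  ℚP.nonNegative⁻¹ (p * q) {{ℚP.nonNeg*nonNeg⇒nonNeg p {{ℚ.nonNegative 0≤p}} q {{ℚ.nonNegative 0≤q}}}}

0≤∧≢0⇒0< : ∀ {p} → 0ℚ ≤ p → p ≢ 0ℚ → 0ℚ < p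
0≤∧≢0⇒0< {p} 0≤p p≢0 with ℚP.<-cmp 0ℚ p
... | tri< 0<p _ _ = 0<p
... | tri≈ _ 0≡p _ = ⊥-elim (p≢0 (sym 0≡p))
... | tri> _ _ p<0 = ⊥-elim (ℚP.<-irrefl refl (ℚP.<-≤-trans p<0 0≤p))

0<* : ∀ {p q} → 0ℚ < p → 0ℚ < q → 0ℚ < p * q
0<* {p} {q} 0<p 0<q =
  ℚP.positive⁻¹ (p * q) {{ℚP.pos*pos⇒pos p {{ℚ.positive 0<p}} q {{ℚ.positive 0<q}}}}

-- Sums over subsets and the polytopes P(z)

sumIn : ∀ {n} → Subset n → Vec ℚ n → ℚ
sumIn []      []      = 0ℚ
sumIn (b ∷ I) (x ∷ t) = (if b then x else 0ℚ) + sumIn I t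

sumOver≡sumIn : ∀ {n} (I : Subset n) (t : Vec ℚ n) → sumOver I t ≡ sumIn I t
sumOver≡sumIn []      []      = refl
sumOver≡sumIn (b ∷ I) (x ∷ t) = cong₂ _+_ (head b) (trans tail (sumOver≡sumIn I t))
  where
  head : ∀ b → (if ⌊ SubsetP._∈?_ Fin.zero (b ∷ I) ⌋ then x else 0ℚ) ≡ (if b then x else 0ℚ)
  head true  = refl
  head false = refl
  tail : sumℚ (Vec.toList (tabulate λ i → if ⌊ SubsetP._∈?_ (Fin.suc i) (b ∷ I) ⌋ then lookup t i else 0ℚ))
       ≡ sumOver I t
  tail = cong (λ v → sumℚ (Vec.toList v)) (VecP.tabulate-cong λ i →
           cong (if_then lookup t i else 0ℚ) (⌊⌋-map′ _ _ (SubsetP._∈?_ i I)))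

sumIn-⊥ : ∀ {n} (t : Vec ℚ n) → sumIn ⊥ t ≡ 0ℚ
sumIn-⊥ []      = refl
sumIn-⊥ (x ∷ t) = trans (ℚP.+-identityˡ (sumIn ⊥ t)) (sumIn-⊥ t)

sumIn-modular : ∀ {n} (I J : Subset n) (t : Vec ℚ n) →
                sumIn I t + sumIn J t ≡ sumIn (I ∪ J) t + sumIn (I ∩ J) t
sumIn-modular [] [] [] = refl
sumIn-modular (a ∷ I) (b ∷ J) (x ∷ t) = begin
    (sel a + sumIn I t) + (sel b + sumIn J t)
  ≡⟨ interchange (sel a) _ (sel b) _ ⟩
    (sel a + sel b) + (sumIn I t + sumIn J t)
  ≡⟨ cong₂ _+_ (head a b) (sumIn-modular I J t) ⟩
    (sel (a ∨ b) + sel (a ∧ b)) + (sumIn (I ∪ J) t + sumIn (I ∩ J) t)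
  ≡⟨ interchange (sel (a ∨ b)) (sel (a ∧ b)) _ _ ⟩
    (sel (a ∨ b) + sumIn (I ∪ J) t) + (sel (a ∧ b) + sumIn (I ∩ J) t) ∎
  where
  open ≡-Reasoning
  sel : Bool → ℚ
  sel b = if b then x else 0ℚ
  head : ∀ a b → sel a + sel b ≡ sel (a ∨ b) + sel (a ∧ b)
  head true  true  = refl
  head true  false = refl
  head false true  = ℚP.+-comm 0ℚ x
  head false false = refl

sumIn-0 : ∀ {n} (I : Subset n) → sumIn I 0ᵥ ≡ 0ℚ
sumIn-0 []          = refl
sumIn-0 (true ∷ I)  = cong (0ℚ +_) (sumIn-0 I)
sumIn-0 (false ∷ I) = cong (0ℚ +_) (sumIn-0 I)

sumIn-+ : ∀ {n} (I : Subset n) (u v : Vec ℚ n) → sumIn I (u +ᵥ v) ≡ sumIn I u + sumIn I v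
sumIn-+ []      []      []      = refl
sumIn-+ (b ∷ I) (x ∷ u) (y ∷ v) =
  trans (cong₂ _+_ (head b) (sumIn-+ I u v)) (interchange (sel b x) (sel b y) _ _)
  where
  sel : Bool → ℚ → ℚ
  sel b x = if b then x else 0ℚ
  head : ∀ b → sel b (x + y) ≡ sel b x + sel b y
  head true  = refl
  head false = refl

sumIn-* : ∀ {n} (I : Subset n) (c : ℚ) (u : Vec ℚ n) → sumIn I (c *ᵥ u) ≡ c * sumIn I u
sumIn-* []      c []      = sym (ℚP.*-zeroʳ c)
sumIn-* (b ∷ I) c (x ∷ u) =
  trans (cong₂ _+_ (head b) (sumIn-* I c u)) (sym (ℚP.*-distribˡ-+ c (if b then x else 0ℚ) _))
  where
  head : ∀ b → (if b then c * x else 0ℚ) ≡ c * (if b then x else 0ℚ)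
  head true  = refl
  head false = sym (ℚP.*-zeroʳ c)

SubmodularIneq : ∀ {n} → (Subset n → ℚ) → Set
SubmodularIneq z = ∀ I J → z (I ∪ J) + z (I ∩ J) ≤ z I + z J

-- P(z), with the redundant inequality for I = ⊤ included.
Base : ∀ {n} → (Subset n → ℚ) → Vec ℚ n → Set
Base z t = (∀ I → sumIn I t ≤ z I) × (sumIn ⊤ t ≡ z ⊤)

InP⇔Base : ∀ {n} (z : Subset n → ℚ) t → InP z t ⇔ Base z t
InP⇔Base z t = mk⇔ to from
  where
  to : InP z t → Base z t
  to (ineq , eq) = bound , trans (sym (sumOver≡sumIn ⊤ t)) eq
    where
    bound : ∀ I → sumIn I t ≤ z I
    bound I with VecP.≡-dec Data.Bool._≟_ I ⊤
    ... | yes refl = ℚP.≤-reflexive (trans (sym (sumOver≡sumIn ⊤ t)) eq)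
    ... | no I≢⊤  = subst (_≤ z I) (sumOver≡sumIn I t) (ineq I I≢⊤)
  from : Base z t → InP z t
  from (ineq , eq) = (λ I _ → subst (_≤ z I) (sym (sumOver≡sumIn I t)) (ineq I)) , trans (sumOver≡sumIn ⊤ t) eq

Base-[] : (z : Subset 0 → ℚ) → z ⊥ ≡ 0ℚ → Base z []
Base-[] z z⊥≡0 = (λ { [] → ℚP.≤-reflexive (sym z⊥≡0) }) , sym z⊥≡0

Base-+ : ∀ {n} (z₁ z₂ : Subset n → ℚ) {u v} → Base z₁ u → Base z₂ v → Base (λ I → z₁ I + z₂ I) (u +ᵥ v)
Base-+ z₁ z₂ {u} {v} (ineq₁ , eq₁) (ineq₂ , eq₂) =
  (λ I → subst (_≤ _) (sym (sumIn-+ I u v)) (ℚP.+-mono-≤ (ineq₁ I) (ineq₂ I))) ,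
  trans (sumIn-+ ⊤ u v) (cong₂ _+_ eq₁ eq₂)

Submodular-+ : ∀ {n} (z₁ z₂ : Subset n → ℚ) → Submodular z₁ → Submodular z₂ →
               Submodular (λ I → z₁ I + z₂ I)
Submodular-+ z₁ z₂ (z₁⊥≡0 , sub₁) (z₂⊥≡0 , sub₂) =
  cong₂ _+_ z₁⊥≡0 z₂⊥≡0 ,
  λ I J → ≤-byDifference (p≤q⇒0≤q-p (sub₁ I J) ⊕ p≤q⇒0≤q-p (sub₂ I J))
                         (split (z₁ I) (z₂ I) (z₁ J) (z₂ J)
                                (z₁ (I ∪ J)) (z₂ (I ∪ J)) (z₁ (I ∩ J)) (z₂ (I ∩ J)))
  where
  split : ∀ a₁ a₂ b₁ b₂ c₁ c₂ d₁ d₂ →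
          ((a₁ + a₂) + (b₁ + b₂)) - ((c₁ + c₂) + (d₁ + d₂))
          ≡ ((a₁ + b₁) - (c₁ + d₁)) + ((a₂ + b₂) - (c₂ + d₂))
  split = solve-∀ ℚ-ring

≤⊓+⊓ : ∀ {s a b c d} → s ≤ a + c → s ≤ a + d → s ≤ b + c → s ≤ b + d → s ≤ (a ⊓ b) + (c ⊓ d)
≤⊓+⊓ {a = a} {b} {c} {d} s≤a+c s≤a+d s≤b+c s≤b+d with ℚP.⊓-sel a b | ℚP.⊓-sel c d
... | inj₁ a⊓b≡a | inj₁ c⊓d≡c rewrite a⊓b≡a | c⊓d≡c = s≤a+c
... | inj₁ a⊓b≡a | inj₂ c⊓d≡d rewrite a⊓b≡a | c⊓d≡d = s≤a+d
... | inj₂ a⊓b≡b | inj₁ c⊓d≡c rewrite a⊓b≡b | c⊓d≡c = s≤b+c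
... | inj₂ a⊓b≡b | inj₂ c⊓d≡d rewrite a⊓b≡b | c⊓d≡d = s≤b+d

-- The cross condition says that b - a can only grow from I to I ∩ J.
⊓-submodular : ∀ {n} (a b : Subset n → ℚ) → SubmodularIneq a → SubmodularIneq b →
               (∀ I J → a (I ∩ J) + b I ≤ a I + b (I ∩ J)) → SubmodularIneq (λ I → a I ⊓ b I)
⊓-submodular a b sub-a sub-b cross I J =
  ≤⊓+⊓ {a = a I} {b I} {a J} {b J}
       (ℚP.≤-trans (ℚP.+-mono-≤ (ℚP.p⊓q≤p a∪ b∪) (ℚP.p⊓q≤p a∩ b∩)) (sub-a I J))
       (ℚP.≤-trans (ℚP.+-mono-≤ (ℚP.p⊓q≤q a∪ b∪) (ℚP.p⊓q≤p a∩ b∩)) (mixed I J))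
       (ℚP.≤-trans (ℚP.+-mono-≤ (ℚP.p⊓q≤q a∪ b∪) (ℚP.p⊓q≤p a∩ b∩)) mixed′)
       (ℚP.≤-trans (ℚP.+-mono-≤ (ℚP.p⊓q≤q a∪ b∪) (ℚP.p⊓q≤q a∩ b∩)) (sub-b I J))
  where
  mixed : ∀ I J → b (I ∪ J) + a (I ∩ J) ≤ a I + b J
  mixed I J = ≤-byDifference (p≤q⇒0≤q-p (sub-b I J) ⊕ p≤q⇒0≤q-p (cross I J))
                             (rearrange (a I) (b J) (b (I ∪ J)) (a (I ∩ J)) (b I) (b (I ∩ J)))
    where
    rearrange : ∀ aI bJ bI∪J aI∩J bI bI∩J →
      (aI + bJ) - (bI∪J + aI∩J) ≡ ((bI + bJ) - (bI∪J + bI∩J)) + ((aI + bI∩J) - (aI∩J + bI))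
    rearrange = solve-∀ ℚ-ring
  mixed′ : b (I ∪ J) + a (I ∩ J) ≤ b I + a J
  mixed′ = subst₂ (λ K L → b K + a L ≤ b I + a J) (SubsetP.∪-comm J I) (SubsetP.∩-comm J I)
             (subst (b (J ∪ I) + a (J ∩ I) ≤_) (ℚP.+-comm (a J) (b I)) (mixed J I))
  a∪ = a (I ∪ J)
  b∪ = b (I ∪ J)
  a∩ = a (I ∩ J)
  b∩ = b (I ∩ J)

-- Slicing P(z) along the first coordinate

marginal : ∀ {n} → (Subset (suc n) → ℚ) → Subset n → ℚ
marginal z I = z (true ∷ I) - z (false ∷ I)

-- For marginal z ⊤ ≤ c ≤ z (true ∷ ⊥), slice z c describes {t : c ∷ t ∈ P(z)}.
slice : ∀ {n} → (Subset (suc n) → ℚ) → ℚ → Subset n → ℚ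
slice z c I = z (false ∷ I) ⊓ (z (true ∷ I) - c)

module _ {n : ℕ} (z : Subset (suc n) → ℚ) where

  marginal-antitone : SubmodularIneq z →
                      ∀ I J → marginal z I ≤ marginal z (I ∩ J)
  marginal-antitone sub I J =
    ≤-byDifference (p≤q⇒0≤q-p sub-at-I∩J,I)
                   (difference-of-differences (z (true ∷ (I ∩ J))) (z (false ∷ (I ∩ J))) (z (true ∷ I)) (z (false ∷ I)))
    where
    difference-of-differences : ∀ p q r s → (p - q) - (r - s) ≡ (p + s) - (r + q)
    difference-of-differences = solve-∀ ℚ-ring
    sub-at-I∩J,I : z (true ∷ I) + z (false ∷ (I ∩ J)) ≤ z (true ∷ (I ∩ J)) + z (false ∷ I)
    sub-at-I∩J,I =
      subst₂ (λ K L → z (true ∷ K) + z (false ∷ L) ≤ z (true ∷ (I ∩ J)) + z (false ∷ I))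
             (trans (SubsetP.∪-comm (I ∩ J) I) (SubsetP.∪-abs-∩ I J))
             (trans (SubsetP.∩-comm (I ∩ J) I) (trans (sym (SubsetP.∩-assoc I I J)) (cong (_∩ J) (SubsetP.∩-idem I))))
             (sub (true ∷ (I ∩ J)) (false ∷ I))

  marginal-⊥ : z ⊥ ≡ 0ℚ → marginal z ⊥ ≡ z (true ∷ ⊥)
  marginal-⊥ z⊥≡0 = trans (cong (λ q → z (true ∷ ⊥) - q) z⊥≡0) (ℚP.+-identityʳ (z (true ∷ ⊥)))

  marginal≤singleton : Submodular z → ∀ I → marginal z I ≤ z (true ∷ ⊥)
  marginal≤singleton (z⊥≡0 , sub) I =
    subst (marginal z I ≤_) (trans (cong (marginal z) (SubsetP.∩-zeroʳ I)) (marginal-⊥ z⊥≡0)) (marginal-antitone sub I ⊥)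

  marginal-⊤≤marginal : SubmodularIneq z → ∀ I → marginal z ⊤ ≤ marginal z I
  marginal-⊤≤marginal sub I =
    subst (marginal z ⊤ ≤_) (cong (marginal z) (SubsetP.∩-identityˡ I)) (marginal-antitone sub ⊤ I)

  slice-when-c≤marginal : ∀ {c} I → c ≤ marginal z I → slice z c I ≡ z (false ∷ I)
  slice-when-c≤marginal I c≤m = ℚP.p≤q⇒p⊓q≡p (q≤p-r⇒r≤p-q {z (true ∷ I)} c≤m)

  slice-when-marginal≤c : ∀ {c} I → marginal z I ≤ c → slice z c I ≡ z (true ∷ I) - c
  slice-when-marginal≤c I m≤c = ℚP.p≥q⇒p⊓q≡q {z (false ∷ I)} (p-r≤q⇒p-q≤r {z (true ∷ I)} m≤c)

  slice-submodular : ∀ {c} → Submodular z → c ≤ z (true ∷ ⊥) → Submodular (slice z c)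
  slice-submodular {c} (z⊥≡0 , sub) c≤z₁ =
    trans (slice-when-c≤marginal ⊥ (subst (c ≤_) (sym (marginal-⊥ z⊥≡0)) c≤z₁)) z⊥≡0 ,
    ⊓-submodular (λ I → z (false ∷ I)) (λ I → z (true ∷ I) - c) sub₀ sub₁ cross
    where
    sub₀ : SubmodularIneq (λ I → z (false ∷ I))
    sub₀ I J = sub (false ∷ I) (false ∷ J)
    sub₁ : SubmodularIneq (λ I → z (true ∷ I) - c)
    sub₁ I J = ≤-byDifference (p≤q⇒0≤q-p (sub (true ∷ I) (true ∷ J)))
                              (rearrange (z (true ∷ (I ∪ J))) (z (true ∷ (I ∩ J))) (z (true ∷ I)) (z (true ∷ J)) c)
      where
      rearrange : ∀ u v p q c → ((p - c) + (q - c)) - ((u - c) + (v - c)) ≡ (p + q) - (u + v)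
      rearrange = solve-∀ ℚ-ring
    cross : ∀ I J → z (false ∷ (I ∩ J)) + (z (true ∷ I) - c) ≤ z (false ∷ I) + (z (true ∷ (I ∩ J)) - c)
    cross I J = ≤-byDifference (p≤q⇒0≤q-p (marginal-antitone sub I J))
                  (rearrange (z (true ∷ I)) (z (false ∷ I)) (z (true ∷ (I ∩ J))) (z (false ∷ (I ∩ J))) c)
      where
      rearrange : ∀ p q r s c → (q + (r - c)) - (s + (p - c)) ≡ (r - s) - (p - q)
      rearrange = solve-∀ ℚ-ring

  Base-∷ : ∀ {c t} → Base (slice z c) t → marginal z ⊤ ≤ c → Base z (c ∷ t)
  Base-∷ {c} {t} (ineq , eq) m⊤≤c =
    bound , trans (cong (c +_) (trans eq (slice-when-marginal≤c ⊤ m⊤≤c))) (p+[q-p]≡q c (z ⊤))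
    where
    bound : ∀ I → sumIn I (c ∷ t) ≤ z I
    bound (false ∷ I) = subst (_≤ z (false ∷ I)) (sym (ℚP.+-identityˡ (sumIn I t)))
                          (ℚP.≤-trans (ineq I) (ℚP.p⊓q≤p (z (false ∷ I)) (z (true ∷ I) - c)))
    bound (true ∷ I)  =
      ℚP.≤-trans (ℚP.+-monoʳ-≤ c (ℚP.≤-trans (ineq I) (ℚP.p⊓q≤q (z (false ∷ I)) (z (true ∷ I) - c))))
                 (ℚP.≤-reflexive (p+[q-p]≡q c (z (true ∷ I))))

-- The greedy vertex of P(z) that is tight at I: fill in the coordinates of I first.
Base-tight : ∀ n {z : Subset n → ℚ} → Submodular z → ∀ I → ∃[ v ] Base z v × sumIn I v ≡ z I
Base-tight zero    {z} (z⊥≡0 , _) [] = [] , Base-[] z z⊥≡0 , sym z⊥≡0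
Base-tight (suc n) {z} sz (true ∷ I) =
  let (v , base , tight) = Base-tight n (slice-submodular z sz ℚP.≤-refl) I in
  (c ∷ v) , Base-∷ z base (marginal≤singleton z sz ⊤) ,
  trans (cong (c +_) (trans tight (slice-when-marginal≤c z I (marginal≤singleton z sz I)))) (p+[q-p]≡q c (z (true ∷ I)))
  where c = z (true ∷ ⊥)
Base-tight (suc n) {z} sz@(_ , sub) (false ∷ I) =
  let (v , base , tight) = Base-tight n (slice-submodular z sz (marginal≤singleton z sz ⊤)) I in
  (c ∷ v) , Base-∷ z base ℚP.≤-refl ,
  trans (ℚP.+-identityˡ (sumIn I v)) (trans tight (slice-when-c≤marginal z I (marginal-⊤≤marginal z sub I)))
  where c = marginal z ⊤

-- Splitting the points of P(z₁ + z₂)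

record AdditiveSubgroup (P : ℚ → Set) : Set where
  field
    0∈         : P 0ℚ
    +-closed   : ∀ {p q} → P p → P q → P (p + q)
    neg-closed : ∀ {p} → P p → P (- p)

  minus-closed : ∀ {p q} → P p → P q → P (p - q)
  minus-closed Pp Pq = +-closed Pp (neg-closed Pq)

  ⊓-closed : ∀ {p q} → P p → P q → P (p ⊓ q)
  ⊓-closed {p} {q} Pp Pq with ℚP.⊓-sel p q
  ... | inj₁ p⊓q≡p = subst P (sym p⊓q≡p) Pp
  ... | inj₂ p⊓q≡q = subst P (sym p⊓q≡q) Pq

  sumIn-closed : ∀ {n} (I : Subset n) {t} → AllV P t → P (sumIn I t)
  sumIn-closed []          []          = 0∈
  sumIn-closed (true ∷ I)  (Px ∷ Pt) = +-closed Px (sumIn-closed I Pt)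
  sumIn-closed (false ∷ I) (Px ∷ Pt) = +-closed 0∈ (sumIn-closed I Pt)

subsets : ∀ n → List (Subset n)
subsets zero    = [] ∷ []
subsets (suc n) = List.map (false ∷_) (subsets n) ++ List.map (true ∷_) (subsets n)

∈-subsets : ∀ {n} (I : Subset n) → I ∈ subsets n
∈-subsets []          = here refl
∈-subsets (false ∷ I) = ∈-++⁺ˡ (∈-map⁺ (false ∷_) (∈-subsets I))
∈-subsets (true ∷ I)  = ∈-++⁺ʳ _ (∈-map⁺ (true ∷_) (∈-subsets I))

maximiser : ∀ {n} → (Subset n → ℚ) → Subset n
maximiser h = argmax h ⊥ (subsets _)

≤maximiser : ∀ {n} (h : Subset n → ℚ) I → h I ≤ h (maximiser h)
≤maximiser h I = ListAll.lookup (f[xs]≤f[argmax] ⊥ (subsets _)) (∈-subsets I)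

record Splitting (P : ℚ → Set) {n} (z₁ z₂ : Subset n → ℚ) (x : Vec ℚ n) : Set where
  constructor splitting
  field
    part₁ part₂ : Vec ℚ n
    base₁       : Base z₁ part₁
    base₂       : Base z₂ part₂
    sum         : part₁ +ᵥ part₂ ≡ x
    part₁∈      : AllV P part₁
    part₂∈      : AllV P part₂

-- A point x₀ ∷ x of P(z₁ + z₂) splits with first coordinates c and x₀ - c whenever
-- lower I ≤ c ≤ upper J for all I and J; such c exist because lower ≤ upper.
module FirstCoordinate {n} (z₁ z₂ : Subset (suc n) → ℚ) (sz₁ : Submodular z₁) (sz₂ : Submodular z₂)
                       (x₀ : ℚ) (x : Vec ℚ n) (base : Base (λ I → z₁ I + z₂ I) (x₀ ∷ x)) where

  lower : Subset n → ℚ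
  lower I = ((x₀ + sumIn I x) - z₁ (false ∷ I)) - z₂ (true ∷ I)

  upper : Subset n → ℚ
  upper J = (z₁ (true ∷ J) + z₂ (false ∷ J)) - sumIn J x

  private
    ineq : ∀ I → sumIn I (x₀ ∷ x) ≤ z₁ I + z₂ I
    ineq = proj₁ base

    ineq-false : ∀ I → sumIn I x ≤ z₁ (false ∷ I) + z₂ (false ∷ I)
    ineq-false I = subst (_≤ _) (ℚP.+-identityˡ (sumIn I x)) (ineq (false ∷ I))

    eq : x₀ + sumIn ⊤ x ≡ z₁ ⊤ + z₂ ⊤
    eq = proj₂ base

    p+0-0≡p : ∀ p → (p + 0ℚ) - 0ℚ ≡ p
    p+0-0≡p = solve-∀ ℚ-ring

  lower≤upper : ∀ I J → lower I ≤ upper J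
  lower≤upper I J =
    ≤-byDifference (p≤q⇒0≤q-p (ineq (true ∷ (I ∪ J))) ⊕ p≤q⇒0≤q-p (ineq-false (I ∩ J))
                    ⊕ p≤q⇒0≤q-p (proj₂ sz₁ (false ∷ I) (true ∷ J))
                    ⊕ p≤q⇒0≤q-p (proj₂ sz₂ (true ∷ I) (false ∷ J))
                    ⊕ p≤q⇒0≤q-p (ℚP.≤-reflexive (sumIn-modular I J x)))
                   (rearrange x₀ (sumIn I x) (sumIn J x) (sumIn (I ∪ J) x) (sumIn (I ∩ J) x)
                              (z₁ (true ∷ (I ∪ J))) (z₂ (true ∷ (I ∪ J)))
                              (z₁ (false ∷ (I ∩ J))) (z₂ (false ∷ (I ∩ J)))
                              (z₁ (false ∷ I)) (z₁ (true ∷ J)) (z₂ (true ∷ I)) (z₂ (false ∷ J)))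
    where
    rearrange : ∀ x₀ σI σJ σ∪ σ∩ a₁∪ b₁∪ a₀∩ b₀∩ a₀I a₁J b₁I b₀J →
      ((a₁J + b₀J) - σJ) - (((x₀ + σI) - a₀I) - b₁I)
      ≡ ((a₁∪ + b₁∪) - (x₀ + σ∪)) + ((a₀∩ + b₀∩) - σ∩) + ((a₀I + a₁J) - (a₁∪ + a₀∩))
        + ((b₁I + b₀J) - (b₁∪ + b₀∩)) + ((σ∪ + σ∩) - (σI + σJ))
    rearrange = solve-∀ ℚ-ring

  module Admissible (c : ℚ) (lower≤c : ∀ I → lower I ≤ c) (c≤upper : ∀ J → c ≤ upper J) where

    c≤z₁ : c ≤ z₁ (true ∷ ⊥)
    c≤z₁ = ℚP.≤-trans (c≤upper ⊥) (ℚP.≤-reflexive upper-⊥)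
      where
      upper-⊥ : upper ⊥ ≡ z₁ (true ∷ ⊥)
      upper-⊥ = trans (cong₂ (λ u v → (z₁ (true ∷ ⊥) + u) - v) (proj₁ sz₂) (sumIn-⊥ x)) (p+0-0≡p _)

    x₀-c≤z₂ : x₀ - c ≤ z₂ (true ∷ ⊥)
    x₀-c≤z₂ = p-r≤q⇒p-q≤r {x₀} (subst (_≤ c) lower-⊥ (lower≤c ⊥))
      where
      lower-⊥ : lower ⊥ ≡ x₀ - z₂ (true ∷ ⊥)
      lower-⊥ = cong (_- z₂ (true ∷ ⊥))
                     (trans (cong₂ (λ u v → (x₀ + u) - v) (sumIn-⊥ x) (proj₁ sz₁)) (p+0-0≡p x₀))

    marginal₁≤c : marginal z₁ ⊤ ≤ c
    marginal₁≤c = subst (_≤ c) lower-⊤ (lower≤c ⊤)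
      where
      rearrange : ∀ a b c → ((a + b) - c) - b ≡ a - c
      rearrange = solve-∀ ℚ-ring
      lower-⊤ : lower ⊤ ≡ marginal z₁ ⊤
      lower-⊤ = trans (cong (λ u → (u - z₁ (false ∷ ⊤)) - z₂ ⊤) eq)
                      (rearrange (z₁ ⊤) (z₂ ⊤) (z₁ (false ∷ ⊤)))

    marginal₂≤x₀-c : marginal z₂ ⊤ ≤ x₀ - c
    marginal₂≤x₀-c = q≤p-r⇒r≤p-q {x₀} (subst (c ≤_) upper-⊤ (c≤upper ⊤))
      where
      rearrange : ∀ a b d s → (a + d) - s ≡ ((a + b) - s) - (b - d)
      rearrange = solve-∀ ℚ-ring
      p+q-q≡p : ∀ p q → (p + q) - q ≡ p
      p+q-q≡p = solve-∀ ℚ-ring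
      upper-⊤ : upper ⊤ ≡ x₀ - marginal z₂ ⊤
      upper-⊤ = begin
          (z₁ ⊤ + z₂ (false ∷ ⊤)) - sumIn ⊤ x
        ≡⟨ rearrange (z₁ ⊤) (z₂ ⊤) (z₂ (false ∷ ⊤)) (sumIn ⊤ x) ⟩
          ((z₁ ⊤ + z₂ ⊤) - sumIn ⊤ x) - marginal z₂ ⊤
        ≡⟨ cong (λ u → (u - sumIn ⊤ x) - marginal z₂ ⊤) (sym eq) ⟩
          ((x₀ + sumIn ⊤ x) - sumIn ⊤ x) - marginal z₂ ⊤
        ≡⟨ cong (_- marginal z₂ ⊤) (p+q-q≡p x₀ (sumIn ⊤ x)) ⟩
          x₀ - marginal z₂ ⊤ ∎
        where open ≡-Reasoning

    tail-base : Base (λ I → slice z₁ c I + slice z₂ (x₀ - c) I) x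
    tail-base = bound , sum-⊤
      where
      bound : ∀ I → sumIn I x ≤ slice z₁ c I + slice z₂ (x₀ - c) I
      bound I = ≤⊓+⊓ {a = z₁ (false ∷ I)} {z₁ (true ∷ I) - c} {z₂ (false ∷ I)} {z₂ (true ∷ I) - (x₀ - c)}
        (ineq-false I)
        (≤-byDifference (p≤q⇒0≤q-p (lower≤c I)) (via-lower (z₁ (false ∷ I)) (z₂ (true ∷ I)) x₀ c (sumIn I x)))
        (≤-byDifference (p≤q⇒0≤q-p (c≤upper I)) (via-upper (z₁ (true ∷ I)) (z₂ (false ∷ I)) c (sumIn I x)))
        (≤-byDifference (p≤q⇒0≤q-p (ineq (true ∷ I))) (via-true (z₁ (true ∷ I)) (z₂ (true ∷ I)) x₀ c (sumIn I x)))
        where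
        via-lower : ∀ a b x c s → (a + (b - (x - c))) - s ≡ c - (((x + s) - a) - b)
        via-lower = solve-∀ ℚ-ring
        via-upper : ∀ a b c s → ((a - c) + b) - s ≡ ((a + b) - s) - c
        via-upper = solve-∀ ℚ-ring
        via-true : ∀ a b x c s → ((a - c) + (b - (x - c))) - s ≡ (a + b) - (x + s)
        via-true = solve-∀ ℚ-ring
      sum-⊤ : sumIn ⊤ x ≡ slice z₁ c ⊤ + slice z₂ (x₀ - c) ⊤
      sum-⊤ = begin
          sumIn ⊤ x
        ≡⟨ p≡[q+p]-q (sumIn ⊤ x) x₀ ⟩
          (x₀ + sumIn ⊤ x) - x₀
        ≡⟨ cong (_- x₀) eq ⟩
          (z₁ ⊤ + z₂ ⊤) - x₀
        ≡⟨ split-at (z₁ ⊤) (z₂ ⊤) x₀ c ⟩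
          (z₁ ⊤ - c) + (z₂ ⊤ - (x₀ - c))
        ≡⟨ sym (cong₂ _+_ (slice-when-marginal≤c z₁ ⊤ marginal₁≤c)
                          (slice-when-marginal≤c z₂ ⊤ marginal₂≤x₀-c)) ⟩
          slice z₁ c ⊤ + slice z₂ (x₀ - c) ⊤ ∎
        where
        open ≡-Reasoning
        p≡[q+p]-q : ∀ p q → p ≡ (q + p) - q
        p≡[q+p]-q = solve-∀ ℚ-ring
        split-at : ∀ a b x c → (a + b) - x ≡ (a - c) + (b - (x - c))
        split-at = solve-∀ ℚ-ring

-- Edmonds' decomposition theorem, relative to an additive subgroup P of ℚ.
module _ {P : ℚ → Set} (P-subgroup : AdditiveSubgroup P) where
  open AdditiveSubgroup P-subgroup

  Base-split : ∀ n (z₁ z₂ : Subset n → ℚ) → Submodular z₁ → Submodular z₂ →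
               (∀ I → P (z₁ I)) → (∀ I → P (z₂ I)) →
               ∀ {x} → AllV P x → Base (λ I → z₁ I + z₂ I) x → Splitting P z₁ z₂ x
  Base-split zero z₁ z₂ (z₁⊥≡0 , _) (z₂⊥≡0 , _) _ _ [] _ =
    splitting [] [] (Base-[] z₁ z₁⊥≡0) (Base-[] z₂ z₂⊥≡0) refl [] []
  Base-split (suc n) z₁ z₂ sz₁ sz₂ Pz₁ Pz₂ {x₀ ∷ x} (Px₀ ∷ Px) base =
    splitting (c ∷ part₁) ((x₀ - c) ∷ part₂)
              (Base-∷ z₁ base₁ marginal₁≤c) (Base-∷ z₂ base₂ marginal₂≤x₀-c)
              (cong₂ _∷_ (p+[q-p]≡q c x₀) sum) (Pc ∷ part₁∈) (minus-closed Px₀ Pc ∷ part₂∈)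
    where
    open FirstCoordinate z₁ z₂ sz₁ sz₂ x₀ x base
    I₀ : Subset n
    I₀ = maximiser lower
    c : ℚ
    c = lower I₀
    Pc : P c
    Pc = minus-closed (minus-closed (+-closed Px₀ (sumIn-closed I₀ Px)) (Pz₁ _)) (Pz₂ _)
    open Admissible c (≤maximiser lower) (lower≤upper I₀)
    open Splitting (Base-split n (slice z₁ c) (slice z₂ (x₀ - c))
                      (slice-submodular z₁ sz₁ c≤z₁) (slice-submodular z₂ sz₂ x₀-c≤z₂)
                      (λ I → ⊓-closed (Pz₁ _) (minus-closed (Pz₁ _) Pc))
                      (λ I → ⊓-closed (Pz₂ _) (minus-closed (Pz₂ _) (minus-closed Px₀ Pc)))
                      Px tail-base)

-- Finite sums and integers

private
  variable
    A B : Set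

∑ : List A → (A → ℚ) → ℚ
∑ xs f = sumℚ (List.map f xs)

syntax ∑ xs (λ x → e) = ∑[ x ← xs ] e

∑-cong : ∀ (xs : List A) {f g : A → ℚ} → (∀ {x} → x ∈ xs → f x ≡ g x) → ∑ xs f ≡ ∑ xs g
∑-cong []       f≡g = refl
∑-cong (x ∷ xs) f≡g = cong₂ _+_ (f≡g (here refl)) (∑-cong xs (f≡g ∘ there))

∑-+ : ∀ (xs : List A) (f g : A → ℚ) → ∑[ x ← xs ] (f x + g x) ≡ ∑ xs f + ∑ xs g
∑-+ []       f g = refl
∑-+ (x ∷ xs) f g = trans (cong (f x + g x +_) (∑-+ xs f g)) (interchange (f x) (g x) (∑ xs f) (∑ xs g))

∑-*ˡ : ∀ (xs : List A) c (f : A → ℚ) → ∑[ x ← xs ] (c * f x) ≡ c * ∑ xs f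
∑-*ˡ []       c f = sym (ℚP.*-zeroʳ c)
∑-*ˡ (x ∷ xs) c f = trans (cong (c * f x +_) (∑-*ˡ xs c f)) (sym (ℚP.*-distribˡ-+ c (f x) (∑ xs f)))

∑-*ʳ : ∀ (xs : List A) c (f : A → ℚ) → ∑[ x ← xs ] (f x * c) ≡ ∑ xs f * c
∑-*ʳ xs c f = trans (∑-cong xs (λ {x} _ → ℚP.*-comm (f x) c)) (trans (∑-*ˡ xs c f) (ℚP.*-comm c (∑ xs f)))

∑-zero : ∀ (xs : List A) (f : A → ℚ) → (∀ {x} → x ∈ xs → f x ≡ 0ℚ) → ∑ xs f ≡ 0ℚ
∑-zero []       f f≡0 = refl
∑-zero (x ∷ xs) f f≡0 = cong₂ _+_ (f≡0 (here refl)) (∑-zero xs f (f≡0 ∘ there))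

∑-++ : ∀ (xs ys : List A) (f : A → ℚ) → ∑ (xs ++ ys) f ≡ ∑ xs f + ∑ ys f
∑-++ []       ys f = sym (ℚP.+-identityˡ (∑ ys f))
∑-++ (x ∷ xs) ys f = trans (cong (f x +_) (∑-++ xs ys f)) (sym (ℚP.+-assoc (f x) (∑ xs f) (∑ ys f)))

∑-map : ∀ (k : A → B) (xs : List A) (f : B → ℚ) → ∑ (List.map k xs) f ≡ ∑[ x ← xs ] f (k x)
∑-map k []       f = refl
∑-map k (x ∷ xs) f = cong (f (k x) +_) (∑-map k xs f)

∑-concatMap : ∀ (k : A → List B) (xs : List A) (f : B → ℚ) →
              ∑ (List.concatMap k xs) f ≡ ∑[ x ← xs ] ∑ (k x) f
∑-concatMap k []       f = refl
∑-concatMap k (x ∷ xs) f = trans (∑-++ (k x) (List.concatMap k xs) f) (cong (∑ (k x) f +_) (∑-concatMap k xs f))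

∑-nonneg : ∀ (xs : List A) (f : A → ℚ) → (∀ {x} → x ∈ xs → 0ℚ ≤ f x) → 0ℚ ≤ ∑ xs f
∑-nonneg []       f 0≤f = ℚP.≤-refl
∑-nonneg (x ∷ xs) f 0≤f = 0≤f (here refl) ⊕ ∑-nonneg xs f (0≤f ∘ there)

term≤∑ : ∀ (xs : List A) (f : A → ℚ) → (∀ {x} → x ∈ xs → 0ℚ ≤ f x) →
         ∀ {y} → y ∈ xs → f y ≤ ∑ xs f
term≤∑ (x ∷ xs) f 0≤f (here refl) =
  subst (_≤ f x + ∑ xs f) (ℚP.+-identityʳ (f x)) (ℚP.+-monoʳ-≤ (f x) (∑-nonneg xs f (0≤f ∘ there)))
term≤∑ (x ∷ xs) f 0≤f {y} (there y∈xs) =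
  subst (_≤ f x + ∑ xs f) (ℚP.+-identityˡ (f y))
        (ℚP.+-mono-≤ (0≤f (here refl)) (term≤∑ xs f (0≤f ∘ there) y∈xs))

∑≢0⇒term≢0 : ∀ (xs : List A) (f : A → ℚ) → ∑ xs f ≢ 0ℚ → ∃[ x ] x ∈ xs × f x ≢ 0ℚ
∑≢0⇒term≢0 []       f ∑≢0 = ⊥-elim (∑≢0 refl)
∑≢0⇒term≢0 (x ∷ xs) f ∑≢0 with f x ℚP.≟ 0ℚ
... | no  fx≢0 = x , here refl , fx≢0
... | yes fx≡0 =
  let (y , y∈xs , fy≢0) = ∑≢0⇒term≢0 xs f (λ ∑xs≡0 → ∑≢0 (cong₂ _+_ fx≡0 ∑xs≡0))
  in y , there y∈xs , fy≢0

weighted-∑≤ : ∀ (xs : List A) (w v : A → ℚ) M →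
              (∀ {x} → x ∈ xs → 0ℚ ≤ w x) → (∀ {x} → x ∈ xs → v x ≤ M) →
              ∑[ x ← xs ] (w x * v x) ≤ ∑ xs w * M
weighted-∑≤ []       w v M 0≤w v≤M = ℚP.≤-reflexive (sym (ℚP.*-zeroˡ M))
weighted-∑≤ (x ∷ xs) w v M 0≤w v≤M =
  ℚP.≤-trans (ℚP.+-mono-≤ (ℚP.*-monoˡ-≤-nonNeg (w x) {{ℚ.nonNegative (0≤w (here refl))}} (v≤M (here refl)))
                          (weighted-∑≤ xs w v M (0≤w ∘ there) (v≤M ∘ there)))
             (ℚP.≤-reflexive (sym (ℚP.*-distribʳ-+ M (w x) (∑ xs w))))

IsInteger : ℚ → Set
IsInteger q = ∃[ k ] ℤtoℚ k ≡ q

ℤtoℚ≡fromℤ : ∀ k → ℤtoℚ k ≡ fromℤ k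
ℤtoℚ≡fromℤ k = ℚP.↥p/↧p≡p (fromℤ k)

ℤtoℚ-+ : ∀ a b → ℤtoℚ a + ℤtoℚ b ≡ ℤtoℚ (a ℤ.+ b)
ℤtoℚ-+ a b = trans (cong₂ _+_ (ℤtoℚ≡fromℤ a) (ℤtoℚ≡fromℤ b))
                   (cong₂ (λ u v → (u ℤ.+ v) ℚ./ 1) (ℤP.*-identityʳ a) (ℤP.*-identityʳ b))

ℤtoℚ-neg : ∀ a → - ℤtoℚ a ≡ ℤtoℚ (ℤ.- a)
ℤtoℚ-neg a = trans (cong -_ (ℤtoℚ≡fromℤ a)) (trans (neg-fromℤ a) (sym (ℤtoℚ≡fromℤ (ℤ.- a))))
  where
  neg-fromℤ : ∀ a → - fromℤ a ≡ fromℤ (ℤ.- a)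
  neg-fromℤ (ℤ.+ zero)    = refl
  neg-fromℤ (ℤ.+ (suc n)) = refl
  neg-fromℤ ℤ.-[1+ n ]    = refl

ℤtoℚ-injective : ∀ {a b} → ℤtoℚ a ≡ ℤtoℚ b → a ≡ b
ℤtoℚ-injective {a} {b} eq = cong ℚ.numerator (trans (sym (ℤtoℚ≡fromℤ a)) (trans eq (ℤtoℚ≡fromℤ b)))

ℕtoℚ-+ : ∀ x y → ℕtoℚ (x ℕ.+ y) ≡ ℕtoℚ x + ℕtoℚ y
ℕtoℚ-+ x y = sym (ℤtoℚ-+ (ℤ.+ x) (ℤ.+ y))

integers : AdditiveSubgroup IsInteger
integers = record
  { 0∈         = ℤ.+ 0 , refl
  ; +-closed   = λ { (a , refl) (b , refl) → a ℤ.+ b , sym (ℤtoℚ-+ a b) }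
  ; neg-closed = λ { (a , refl) → ℤ.- a , sym (ℤtoℚ-neg a) }
  }

rationals : AdditiveSubgroup (λ _ → Unit.⊤)
rationals = record { 0∈ = _ ; +-closed = _ ; neg-closed = _ }

ℕ-integral : ∀ {n} (a : Vec ℕ n) → AllV IsInteger (Vec.map ℕtoℚ a)
ℕ-integral []      = []
ℕ-integral (x ∷ a) = (ℤ.+ x , refl) ∷ ℕ-integral a

ℤ-integral : ∀ {n} (k : Vec ℤ n) → AllV IsInteger (Vec.map ℤtoℚ k)
ℤ-integral []      = []
ℤ-integral (x ∷ k) = (x , refl) ∷ ℤ-integral k

integral⇒map-ℤtoℚ : ∀ {n} {y : Vec ℚ n} → AllV IsInteger y → ∃[ k ] Vec.map ℤtoℚ k ≡ y
integral⇒map-ℤtoℚ []                = [] , refl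
integral⇒map-ℤtoℚ ((k , refl) ∷ ky) = let (ks , eq) = integral⇒map-ℤtoℚ ky in k ∷ ks , cong (ℤtoℚ k ∷_) eq

map-ℤtoℚ-injective : ∀ {n} {k l : Vec ℤ n} → Vec.map ℤtoℚ k ≡ Vec.map ℤtoℚ l → k ≡ l
map-ℤtoℚ-injective {k = []}    {[]}    _  = refl
map-ℤtoℚ-injective {k = x ∷ k} {y ∷ l} eq =
  cong₂ _∷_ (ℤtoℚ-injective (VecP.∷-injectiveˡ eq)) (map-ℤtoℚ-injective (VecP.∷-injectiveʳ eq))

map-ℤtoℚ-+ : ∀ {n} (k l : Vec ℤ n) → Vec.map ℤtoℚ (zipWith ℤ._+_ k l) ≡ Vec.map ℤtoℚ k +ᵥ Vec.map ℤtoℚ l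
map-ℤtoℚ-+ []      []      = refl
map-ℤtoℚ-+ (x ∷ k) (y ∷ l) = cong₂ _∷_ (sym (ℤtoℚ-+ x y)) (map-ℤtoℚ-+ k l)

-- Convex hulls of exponent vectors

_+ₑ_ : ∀ {n} → Exp n → Exp n → Exp n
a +ₑ b = zipWith ℕ._+_ a b

point : ∀ {n} → Exp n → Vec ℚ n
point a = Vec.map ℕtoℚ a

point-+ₑ : ∀ {n} (a b : Exp n) → point (a +ₑ b) ≡ point a +ᵥ point b
point-+ₑ []      []      = refl
point-+ₑ (x ∷ a) (y ∷ b) = cong₂ _∷_ (ℕtoℚ-+ x y) (point-+ₑ a b)

map-+-+ₑ : ∀ {n} (a b : Exp n) → Vec.map ℤ.+_ (a +ₑ b) ≡ zipWith ℤ._+_ (Vec.map ℤ.+_ a) (Vec.map ℤ.+_ b)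
map-+-+ₑ []      []      = refl
map-+-+ₑ (x ∷ a) (y ∷ b) = cong (ℤ.+ (x ℕ.+ y) ∷_) (map-+-+ₑ a b)

combination : ∀ {n} → List (ℚ × Exp n) → Vec ℚ n
combination = List.foldr (λ w acc → (proj₁ w *ᵥ point (proj₂ w)) +ᵥ acc) 0ᵥ

sumIn-combination : ∀ {n} (I : Subset n) (ws : List (ℚ × Exp n)) →
                    sumIn I (combination ws) ≡ ∑[ w ← ws ] (proj₁ w * sumIn I (point (proj₂ w)))
sumIn-combination I []       = sumIn-0 I
sumIn-combination I (w ∷ ws) =
  trans (sumIn-+ I _ (combination ws)) (cong₂ _+_ (sumIn-* I (proj₁ w) _) (sumIn-combination I ws))

lookup-combination : ∀ {n} (ws : List (ℚ × Exp n)) i →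
                     lookup (combination ws) i ≡ ∑[ w ← ws ] (proj₁ w * ℕtoℚ (lookup (proj₂ w) i))
lookup-combination []       i = VecP.lookup-replicate i 0ℚ
lookup-combination (w ∷ ws) i =
  trans (VecP.lookup-zipWith _+_ i (proj₁ w *ᵥ point (proj₂ w)) (combination ws))
        (cong₂ _+_ (trans (VecP.lookup-map i (proj₁ w *_) (point (proj₂ w)))
                          (cong (proj₁ w *_) (VecP.lookup-map i ℕtoℚ (proj₂ w))))
                   (lookup-combination ws i))

≡-by-lookup : ∀ {n} {A : Set} {x y : Vec A n} → (∀ i → lookup x i ≡ lookup y i) → x ≡ y
≡-by-lookup {x = x} {y} x≗y = trans (sym (VecP.tabulate∘lookup x)) (trans (VecP.tabulate-cong x≗y) (VecP.tabulate∘lookup y))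

∑∑-* : ∀ (xs : List A) (ys : List B) (f : A → ℚ) (g : B → ℚ) →
       ∑[ x ← xs ] ∑[ y ← ys ] (f x * g y) ≡ ∑ xs f * ∑ ys g
∑∑-* xs ys f g = trans (∑-cong xs (λ {x} _ → ∑-*ˡ ys (f x) g)) (∑-*ʳ xs (∑ ys g) f)

∑∑-barycentre : ∀ (xs : List A) (ys : List B) (f : A → ℚ) (g : B → ℚ) (u : A → ℚ) (v : B → ℚ) →
                ∑ xs f ≡ 1ℚ → ∑ ys g ≡ 1ℚ →
                ∑[ x ← xs ] ∑[ y ← ys ] ((f x * g y) * (u x + v y))
                ≡ ∑[ x ← xs ] (f x * u x) + ∑[ y ← ys ] (g y * v y)
∑∑-barycentre xs ys f g u v ∑f≡1 ∑g≡1 = begin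
    ∑[ x ← xs ] ∑[ y ← ys ] ((f x * g y) * (u x + v y))
  ≡⟨ ∑-cong xs (λ {x} _ → trans (∑-cong ys (λ {y} _ → expand (f x) (g y) (u x) (v y)))
                                 (∑-+ ys (λ y → (f x * u x) * g y) (λ y → f x * (g y * v y)))) ⟩
    ∑[ x ← xs ] (∑[ y ← ys ] ((f x * u x) * g y) + ∑[ y ← ys ] (f x * (g y * v y)))
  ≡⟨ ∑-+ xs _ _ ⟩
    ∑[ x ← xs ] ∑[ y ← ys ] ((f x * u x) * g y) + ∑[ x ← xs ] ∑[ y ← ys ] (f x * (g y * v y))
  ≡⟨ cong₂ _+_ (∑∑-* xs ys (λ x → f x * u x) g) (∑∑-* xs ys f (λ y → g y * v y)) ⟩
    ∑[ x ← xs ] (f x * u x) * ∑ ys g + ∑ xs f * ∑[ y ← ys ] (g y * v y)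
  ≡⟨ cong₂ _+_ (trans (cong (U *_) ∑g≡1) (ℚP.*-identityʳ U)) (trans (cong (_* V) ∑f≡1) (ℚP.*-identityˡ V)) ⟩
    ∑[ x ← xs ] (f x * u x) + ∑[ y ← ys ] (g y * v y) ∎
  where
  open ≡-Reasoning
  U = ∑[ x ← xs ] (f x * u x)
  V = ∑[ y ← ys ] (g y * v y)
  expand : ∀ a b p q → (a * b) * (p + q) ≡ (a * p) * b + a * (b * q)
  expand = solve-∀ ℚ-ring

module _ {n : ℕ} where

  InConvexHull-point : ∀ {S : Exp n → Set} {a} → S a → InConvexHull S (point a)
  InConvexHull-point {a = a} Sa =
    (1ℚ , a) ∷ [] , (λ { _ (here refl) → ℚP.nonNegative⁻¹ 1ℚ , Sa }) , refl , one·a+0≡a (point a)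
    where
    one·a+0≡a : ∀ {m} (v : Vec ℚ m) → (1ℚ *ᵥ v) +ᵥ 0ᵥ ≡ v
    one·a+0≡a []      = refl
    one·a+0≡a (x ∷ v) = cong₂ _∷_ (trans (ℚP.+-identityʳ (1ℚ * x)) (ℚP.*-identityˡ x)) (one·a+0≡a v)

  InConvexHull⇒Base : ∀ {S : Exp n → Set} (z : Subset n → ℚ) → (∀ {a} → S a → Base z (point a)) →
                      ∀ {t} → InConvexHull S t → Base z t
  InConvexHull⇒Base z S⊆B (ws , ws⊆S , ∑ws≡1 , refl) = bound , sum-⊤
    where
    weight≥0 : ∀ {w} → w ∈ ws → 0ℚ ≤ proj₁ w
    weight≥0 w∈ws = proj₁ (ws⊆S _ w∈ws)
    base : ∀ {w} → w ∈ ws → Base z (point (proj₂ w))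
    base w∈ws = S⊆B (proj₂ (ws⊆S _ w∈ws))
    bound : ∀ I → sumIn I (combination ws) ≤ z I
    bound I = ℚP.≤-trans (ℚP.≤-reflexive (sumIn-combination I ws))
                (ℚP.≤-trans (weighted-∑≤ ws proj₁ _ (z I) weight≥0 (λ w∈ws → proj₁ (base w∈ws) I))
                  (ℚP.≤-reflexive (trans (cong (_* z I) ∑ws≡1) (ℚP.*-identityˡ (z I)))))
    sum-⊤ : sumIn ⊤ (combination ws) ≡ z ⊤
    sum-⊤ = trans (sumIn-combination ⊤ ws)
              (trans (∑-cong ws (λ {w} w∈ws → cong (proj₁ w *_) (proj₂ (base w∈ws))))
                (trans (∑-*ʳ ws (z ⊤) proj₁) (trans (cong (_* z ⊤) ∑ws≡1) (ℚP.*-identityˡ (z ⊤)))))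

  InConvexHull-sumIn≤ : ∀ {S : Exp n → Set} I {t} → InConvexHull S t → ∃[ a ] S a × sumIn I t ≤ sumIn I (point a)
  InConvexHull-sumIn≤ I ([] , _ , ∑ws≡1 , _) = ⊥-elim (ℚP.1≢0 (sym ∑ws≡1))
  InConvexHull-sumIn≤ {S} I (ws@(w₀ ∷ _) , ws⊆S , ∑ws≡1 , refl) =
    proj₂ best , proj₂ (ws⊆S best best∈ws) ,
    ℚP.≤-trans (ℚP.≤-reflexive (sumIn-combination I ws))
      (ℚP.≤-trans (weighted-∑≤ ws proj₁ value (value best) (λ w∈ws → proj₁ (ws⊆S _ w∈ws))
                                (ListAll.lookup (f[xs]≤f[argmax] {f = value} w₀ ws)))
        (ℚP.≤-reflexive (trans (cong (_* value best) ∑ws≡1) (ℚP.*-identityˡ (value best)))))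
    where
    value : ℚ × Exp n → ℚ
    value w = sumIn I (point (proj₂ w))
    best : ℚ × Exp n
    best = argmax value w₀ ws
    best∈ws : best ∈ ws
    best∈ws = argmax-all value {P = _∈ ws} (here refl) (ListAll.tabulate (λ w∈ws → w∈ws))

  InConvexHull-+ : ∀ {S T R : Exp n → Set} → (∀ {a b} → S a → T b → R (a +ₑ b)) →
                   ∀ {u v} → InConvexHull S u → InConvexHull T v → InConvexHull R (u +ᵥ v)
  InConvexHull-+ {S} {T} {R} S+T⊆R (ws₁ , ws₁⊆S , ∑ws₁≡1 , refl) (ws₂ , ws₂⊆T , ∑ws₂≡1 , refl) =
    ws , (λ _ → ListAll.lookup ws⊆R) , ∑ws≡1 , ≡-by-lookup coordinate
    where
    pair : ℚ × Exp n → ℚ × Exp n → ℚ × Exp n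
    pair w₁ w₂ = proj₁ w₁ * proj₁ w₂ , proj₂ w₁ +ₑ proj₂ w₂
    ws : List (ℚ × Exp n)
    ws = List.concatMap (λ w₁ → List.map (pair w₁) ws₂) ws₁
    ws⊆R : ListAll.All (λ w → (0ℚ ≤ proj₁ w) × R (proj₂ w)) ws
    ws⊆R = ListAllP.concat⁺ (ListAllP.map⁺ (ListAll.tabulate λ w₁∈ws₁ →
             ListAllP.map⁺ (ListAll.tabulate λ w₂∈ws₂ →
               0≤* (proj₁ (ws₁⊆S _ w₁∈ws₁)) (proj₁ (ws₂⊆T _ w₂∈ws₂)) ,
               S+T⊆R (proj₂ (ws₁⊆S _ w₁∈ws₁)) (proj₂ (ws₂⊆T _ w₂∈ws₂)))))
    ∑ws≡1 : ∑ ws proj₁ ≡ 1ℚ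
    ∑ws≡1 = trans (∑-concatMap _ ws₁ proj₁)
              (trans (∑-cong ws₁ (λ {w₁} _ → ∑-map (pair w₁) ws₂ proj₁))
                (trans (∑∑-* ws₁ ws₂ proj₁ proj₁) (cong₂ _*_ ∑ws₁≡1 ∑ws₂≡1)))
    X : Fin n → ℚ × Exp n → ℚ
    X i w = ℕtoℚ (lookup (proj₂ w) i)
    coordinate : ∀ i → lookup (combination ws) i ≡ lookup (combination ws₁ +ᵥ combination ws₂) i
    coordinate i = begin
        lookup (combination ws) i
      ≡⟨ lookup-combination ws i ⟩
        ∑[ w ← ws ] (proj₁ w * X i w)
      ≡⟨ ∑-concatMap _ ws₁ _ ⟩
        ∑[ w₁ ← ws₁ ] ∑[ w ← List.map (pair w₁) ws₂ ] (proj₁ w * X i w)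
      ≡⟨ ∑-cong ws₁ (λ {w₁} _ → trans (∑-map (pair w₁) ws₂ _) (∑-cong ws₂ (λ {w₂} _ →
           cong (proj₁ w₁ * proj₁ w₂ *_)
                (trans (cong ℕtoℚ (VecP.lookup-zipWith ℕ._+_ i (proj₂ w₁) (proj₂ w₂)))
                       (ℕtoℚ-+ (lookup (proj₂ w₁) i) (lookup (proj₂ w₂) i)))))) ⟩
        ∑[ w₁ ← ws₁ ] ∑[ w₂ ← ws₂ ] ((proj₁ w₁ * proj₁ w₂) * (X i w₁ + X i w₂))
      ≡⟨ ∑∑-barycentre ws₁ ws₂ proj₁ proj₁ (X i) (X i) ∑ws₁≡1 ∑ws₂≡1 ⟩
        ∑[ w₁ ← ws₁ ] (proj₁ w₁ * X i w₁) + ∑[ w₂ ← ws₂ ] (proj₁ w₂ * X i w₂)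
      ≡⟨ sym (cong₂ _+_ (lookup-combination ws₁ i) (lookup-combination ws₂ i)) ⟩
        lookup (combination ws₁) i + lookup (combination ws₂) i
      ≡⟨ sym (VecP.lookup-zipWith _+_ i (combination ws₁) (combination ws₂)) ⟩
        lookup (combination ws₁ +ᵥ combination ws₂) i ∎
      where open ≡-Reasoning

-- Supports of products

_≟ₑ_ : ∀ {n} (a b : Exp n) → Dec (a ≡ b)
_≟ₑ_ = VecP.≡-dec ℕP._≟_

δ : ∀ {n} → Exp n → Exp n → ℚ
δ a b = if ⌊ a ≟ₑ b ⌋ then 1ℚ else 0ℚ

module _ {n : ℕ} where

  δ-refl : ∀ (a : Exp n) → δ a a ≡ 1ℚ
  δ-refl a with a ≟ₑ a
  ... | yes _   = refl
  ... | no  a≢a = ⊥-elim (a≢a refl)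

  δ-≢ : ∀ {a b : Exp n} → a ≢ b → δ a b ≡ 0ℚ
  δ-≢ {a} {b} a≢b with a ≟ₑ b
  ... | yes a≡b = ⊥-elim (a≢b a≡b)
  ... | no  _   = refl

  δ-nonneg : ∀ (a b : Exp n) → 0ℚ ≤ δ a b
  δ-nonneg a b with a ≟ₑ b
  ... | yes _ = ℚP.nonNegative⁻¹ 1ℚ
  ... | no  _ = ℚP.≤-refl

  δ≢0⇒≡ : ∀ {a b : Exp n} → δ a b ≢ 0ℚ → a ≡ b
  δ≢0⇒≡ {a} {b} δ≢0 with a ≟ₑ b
  ... | yes a≡b = a≡b
  ... | no  _   = ⊥-elim (δ≢0 refl)

  ∑-δ : ∀ (x : Exp n) {A} (φ : Exp n → ℚ) → Unique A → x ∈ A → ∑[ a ← A ] (δ x a * φ a) ≡ φ x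
  ∑-δ x {_ ∷ A} φ (x∉A ∷ _) (here refl) =
    trans (cong₂ _+_ (trans (cong (_* φ x) (δ-refl x)) (ℚP.*-identityˡ (φ x)))
                     (∑-zero A (λ a → δ x a * φ a)
                             (λ {a} a∈A → trans (cong (_* φ a) (δ-≢ (ListAll.lookup x∉A a∈A))) (ℚP.*-zeroˡ (φ a)))))
          (ℚP.+-identityʳ (φ x))
  ∑-δ x {a ∷ A} φ (a∉A ∷ unique) (there x∈A) =
    trans (cong₂ _+_ (trans (cong (_* φ a) (δ-≢ (λ x≡a → ListAll.lookup a∉A x∈A (sym x≡a)))) (ℚP.*-zeroˡ (φ a)))
                     (∑-δ x φ unique x∈A))
          (ℚP.+-identityˡ (φ x))

  coeff-∑ : ∀ (p : Poly n) m → coeff p m ≡ ∑[ t ← p ] (proj₂ t * δ (proj₁ t) m)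
  coeff-∑ []            m = refl
  coeff-∑ ((a , c) ∷ p) m with a ≟ₑ m
  ... | yes _ = cong₂ _+_ (sym (ℚP.*-identityʳ c)) (coeff-∑ p m)
  ... | no  _ = trans (coeff-∑ p m) (sym (trans (cong (_+ _) (ℚP.*-zeroʳ c)) (ℚP.+-identityˡ _)))

  exponents : Poly n → List (Exp n)
  exponents p = List.deduplicate _≟ₑ_ (List.map proj₁ p)

  ∈-exponents : ∀ (p : Poly n) {a} → a ∈ List.map proj₁ p → a ∈ exponents p
  ∈-exponents p = ∈-deduplicate⁺ _≟ₑ_

  InSupport⇒∈exponents : ∀ (p : Poly n) {a} → InSupport p a → a ∈ exponents p
  InSupport⇒∈exponents p {a} a∈supp = ∈-exponents p (occurs p a∈supp)
    where
    occurs : ∀ p → coeff p a ≢ 0ℚ → a ∈ List.map proj₁ p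
    occurs []            coeff≢0 = ⊥-elim (coeff≢0 refl)
    occurs ((b , c) ∷ p) coeff≢0 with b ≟ₑ a
    ... | yes b≡a = here (sym b≡a)
    ... | no  _   = there (occurs p coeff≢0)

  ∑-terms-by-exponent : ∀ (p : Poly n) (k : Exp n → ℚ) {A} →
                        Unique A → (∀ {a} → a ∈ List.map proj₁ p → a ∈ A) →
            ∑[ t ← p ] (proj₂ t * k (proj₁ t)) ≡ ∑[ a ← A ] (coeff p a * k a)
  ∑-terms-by-exponent []            k {A} unique covers =
    sym (∑-zero A (λ a → coeff [] a * k a) (λ {a} _ → ℚP.*-zeroˡ (k a)))
  ∑-terms-by-exponent ((b , c) ∷ p) k {A} unique covers = begin
      c * k b + ∑[ t ← p ] (proj₂ t * k (proj₁ t))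
    ≡⟨ cong₂ _+_ (sym (trans (∑-*ˡ A c (λ a → δ b a * k a)) (cong (c *_) (∑-δ b k unique (covers (here refl))))))
                 (∑-terms-by-exponent p k unique (covers ∘ there)) ⟩
      ∑[ a ← A ] (c * (δ b a * k a)) + ∑[ a ← A ] (coeff p a * k a)
    ≡⟨ sym (∑-+ A _ _) ⟩
      ∑[ a ← A ] (c * (δ b a * k a) + coeff p a * k a)
    ≡⟨ ∑-cong A (λ {a} _ → sym (trans (cong (_* k a) (coeff-∷ a)) (distrib c (δ b a) (coeff p a) (k a)))) ⟩
      ∑[ a ← A ] (coeff ((b , c) ∷ p) a * k a) ∎
    where
    open ≡-Reasoning
    coeff-∷ : ∀ a → coeff ((b , c) ∷ p) a ≡ c * δ b a + coeff p a
    coeff-∷ a = trans (coeff-∑ ((b , c) ∷ p) a) (cong (c * δ b a +_) (sym (coeff-∑ p a)))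
    distrib : ∀ c d e k → (c * d + e) * k ≡ c * (d * k) + e * k
    distrib = solve-∀ ℚ-ring

  coeff-· : ∀ (f g : Poly n) m →
            coeff (f · g) m ≡ ∑[ a ← exponents f ] (coeff f a * ∑[ b ← exponents g ] (coeff g b * δ (a +ₑ b) m))
  coeff-· f g m = begin
      coeff (f · g) m
    ≡⟨ coeff-∑ (f · g) m ⟩
      ∑[ t ← f · g ] (proj₂ t * δ (proj₁ t) m)
    ≡⟨ ∑-concatMap _ f _ ⟩
      ∑[ s ← f ] ∑[ t ← List.map (λ t → (proj₁ s +ₑ proj₁ t , proj₂ s * proj₂ t)) g ] (proj₂ t * δ (proj₁ t) m)
    ≡⟨ ∑-cong f (λ {s} _ → trans (∑-map _ g _)
         (trans (∑-cong g (λ {t} _ → ℚP.*-assoc (proj₂ s) (proj₂ t) (δ (proj₁ s +ₑ proj₁ t) m)))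
                (∑-*ˡ g (proj₂ s) (λ t → proj₂ t * δ (proj₁ s +ₑ proj₁ t) m)))) ⟩
      ∑[ s ← f ] (proj₂ s * ∑[ t ← g ] (proj₂ t * δ (proj₁ s +ₑ proj₁ t) m))
    ≡⟨ ∑-terms-by-exponent f _ (deduplicate-! _≟ₑ_ _) (∈-exponents f) ⟩
      ∑[ a ← exponents f ] (coeff f a * ∑[ t ← g ] (proj₂ t * δ (a +ₑ proj₁ t) m))
    ≡⟨ ∑-cong (exponents f) (λ {a} _ →
         cong (coeff f a *_) (∑-terms-by-exponent g (λ b → δ (a +ₑ b) m) (deduplicate-! _≟ₑ_ _) (∈-exponents g))) ⟩
      ∑[ a ← exponents f ] (coeff f a * ∑[ b ← exponents g ] (coeff g b * δ (a +ₑ b) m)) ∎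
    where open ≡-Reasoning

  private
    p*q≢0⇒p≢0 : ∀ {p q} → p * q ≢ 0ℚ → p ≢ 0ℚ
    p*q≢0⇒p≢0 {q = q} pq≢0 p≡0 = pq≢0 (trans (cong (_* q) p≡0) (ℚP.*-zeroˡ q))

    p*q≢0⇒q≢0 : ∀ {p q} → p * q ≢ 0ℚ → q ≢ 0ℚ
    p*q≢0⇒q≢0 {p} pq≢0 q≡0 = pq≢0 (trans (cong (p *_) q≡0) (ℚP.*-zeroʳ p))

  InSupport-·⁻ : ∀ (f g : Poly n) {m} → InSupport (f · g) m →
                 ∃[ a ] ∃[ b ] InSupport f a × InSupport g b × a +ₑ b ≡ m
  InSupport-·⁻ f g {m} m∈fg =
    let (a , _ , fa·inner≢0) = ∑≢0⇒term≢0 (exponents f) (λ a → coeff f a * inner a)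
                                           (λ ∑≡0 → m∈fg (trans (coeff-· f g m) ∑≡0))
        (b , _ , gb·δ≢0)     = ∑≢0⇒term≢0 (exponents g) (λ b → coeff g b * δ (a +ₑ b) m)
                                           (p*q≢0⇒q≢0 {coeff f a} fa·inner≢0)
    in a , b , p*q≢0⇒p≢0 fa·inner≢0 , p*q≢0⇒p≢0 gb·δ≢0 , δ≢0⇒≡ (p*q≢0⇒q≢0 {coeff g b} gb·δ≢0)
    where
    inner : Exp n → ℚ
    inner a = ∑[ b ← exponents g ] (coeff g b * δ (a +ₑ b) m)

  -- With nonnegative coefficients the terms of coeff-· cannot cancel.
  InSupport-·⁺ : ∀ (f g : Poly n) → Nonneg f → Nonneg g →
                 ∀ {a b} → InSupport f a → InSupport g b → InSupport (f · g) (a +ₑ b)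
  InSupport-·⁺ f g f≥0 g≥0 {a} {b} a∈f b∈g coeff≡0 =
    ℚP.<⇒≢ 0<coeff (sym (trans (sym (coeff-· f g m)) coeff≡0))
    where
    m : Exp n
    m = a +ₑ b
    inner : Exp n → ℚ
    inner a′ = ∑[ b′ ← exponents g ] (coeff g b′ * δ (a′ +ₑ b′) m)
    inner-terms≥0 : ∀ a′ {b′} → b′ ∈ exponents g → 0ℚ ≤ coeff g b′ * δ (a′ +ₑ b′) m
    inner-terms≥0 a′ {b′} _ = 0≤* (g≥0 b′) (δ-nonneg (a′ +ₑ b′) m)
    0<inner : 0ℚ < inner a
    0<inner = ℚP.<-≤-trans
      (subst (0ℚ <_) (sym (trans (cong (coeff g b *_) (δ-refl m)) (ℚP.*-identityʳ (coeff g b))))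
             (0≤∧≢0⇒0< (g≥0 b) b∈g))
      (term≤∑ (exponents g) _ (inner-terms≥0 a) (InSupport⇒∈exponents g b∈g))
    0<coeff : 0ℚ < ∑[ a′ ← exponents f ] (coeff f a′ * inner a′)
    0<coeff = ℚP.<-≤-trans (0<* (0≤∧≢0⇒0< (f≥0 a) a∈f) 0<inner)
      (term≤∑ (exponents f) _ (λ {a′} _ → 0≤* (f≥0 a′) (∑-nonneg (exponents g) _ (inner-terms≥0 a′)))
              (InSupport⇒∈exponents f a∈f))

-- Newton polytopes that are generalized permutahedra

module _ {n} (p : Poly n) {z : Subset n → ℚ} (Newton⇔P : ∀ t → InNewton p t ⇔ InP z t) where

  Newton⇒Base : ∀ {t} → InNewton p t → Base z t
  Newton⇒Base {t} = Equivalence.to (InP⇔Base z t) ∘ Equivalence.to (Newton⇔P t)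

  Base⇒Newton : ∀ {t} → Base z t → InNewton p t
  Base⇒Newton {t} = Equivalence.from (Newton⇔P t) ∘ Equivalence.from (InP⇔Base z t)

  Newton-submodular-integral : Submodular z → ∀ I → IsInteger (z I)
  Newton-submodular-integral sz I =
    let (v , v∈P , vI≡zI) = Base-tight n sz I
        (a , a∈p , vI≤aI) = InConvexHull-sumIn≤ I (Base⇒Newton v∈P)
        aI≤zI             = proj₁ (Newton⇒Base (InConvexHull-point a∈p)) I
    in subst IsInteger (ℚP.≤-antisym aI≤zI (subst (_≤ sumIn I (point a)) vI≡zI vI≤aI))
             (AdditiveSubgroup.sumIn-closed integers I (ℕ-integral a))

module Product {n} (f g : Poly n) (f≥0 : Nonneg f) (g≥0 : Nonneg g)
               (z₁ z₂ : Subset n → ℚ) (sz₁ : Submodular z₁) (sz₂ : Submodular z₂)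
               (Newton-f : ∀ t → InNewton f t ⇔ InP z₁ t) (Newton-g : ∀ t → InNewton g t ⇔ InP z₂ t) where

  z : Subset n → ℚ
  z I = z₁ I + z₂ I

  Newton-·⇒Base : ∀ {t} → InNewton (f · g) t → Base z t
  Newton-·⇒Base = InConvexHull⇒Base z support⊆Base
    where
    support⊆Base : ∀ {m} → InSupport (f · g) m → Base z (point m)
    support⊆Base m∈fg =
      let (a , b , a∈f , b∈g , a+b≡m) = InSupport-·⁻ f g m∈fg in
      subst (Base z) (trans (sym (point-+ₑ a b)) (cong point a+b≡m))
            (Base-+ z₁ z₂ (Newton⇒Base f Newton-f (InConvexHull-point a∈f))
                          (Newton⇒Base g Newton-g (InConvexHull-point b∈g)))

  Base⇒Newton-· : ∀ {t} → Base z t → InNewton (f · g) t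
  Base⇒Newton-· {t} t∈B = subst (InNewton (f · g)) sum
    (InConvexHull-+ (InSupport-·⁺ f g f≥0 g≥0) (Base⇒Newton f Newton-f base₁) (Base⇒Newton g Newton-g base₂))
    where open Splitting (Base-split rationals n z₁ z₂ sz₁ sz₂ _ _ (VecAll.universal _ t) t∈B)

  Newton-·⇔Base : ∀ t → InNewton (f · g) t ⇔ Base z t
  Newton-·⇔Base t = mk⇔ Newton-·⇒Base Base⇒Newton-·

  SNP-· : SNP f → SNP g → SNP (f · g)
  SNP-· snp-f snp-g m m∈Newton =
    let open Splitting (Base-split integers n z₁ z₂ sz₁ sz₂
                          (Newton-submodular-integral f Newton-f sz₁) (Newton-submodular-integral g Newton-g sz₂)
                          (ℤ-integral m) (Newton-·⇒Base m∈Newton))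
        (k₁ , k₁≡part₁) = integral⇒map-ℤtoℚ part₁∈
        (k₂ , k₂≡part₂) = integral⇒map-ℤtoℚ part₂∈
        (a , a∈f , a≡k₁) = snp-f k₁ (Base⇒Newton f Newton-f (subst (Base z₁) (sym k₁≡part₁) base₁))
        (b , b∈g , b≡k₂) = snp-g k₂ (Base⇒Newton g Newton-g (subst (Base z₂) (sym k₂≡part₂) base₂))
    in a +ₑ b , InSupport-·⁺ f g f≥0 g≥0 a∈f b∈g ,
       trans (map-+-+ₑ a b)
         (trans (cong₂ (zipWith ℤ._+_) a≡k₁ b≡k₂)
           (map-ℤtoℚ-injective (trans (map-ℤtoℚ-+ k₁ k₂) (trans (cong₂ _+ᵥ_ k₁≡part₁ k₂≡part₂) sum))))

proposition2p4 : (n : ℕ) (f g : Poly n) →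
    Nonneg f → Nonneg g → SNP f → SNP g →
    NewtonIsGenPerm f → NewtonIsGenPerm g →
    NewtonIsGenPerm (f · g) × SNP (f · g)
proposition2p4 n f g f≥0 g≥0 snp-f snp-g (z₁ , sz₁ , Newton-f) (z₂ , sz₂ , Newton-g) =
  (z , Submodular-+ z₁ z₂ sz₁ sz₂ , λ t → ⇔.trans (Newton-·⇔Base t) (⇔.sym (InP⇔Base z t))) ,
  SNP-· snp-f snp-g
  where open Product f g f≥0 g≥0 z₁ z₂ sz₁ sz₂ Newton-f Newton-g
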